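{- For $k \leq a \leq n-k$, we have \[ q^{k(k-1)} \begin{bmatrix} n-a-1 \\ k-1 \end{bmatrix}_q \geq \frac{1}{q^{(a-k)(k-1)}} \left(1 - \frac{1}{q^{n-a-k}} \right) \begin{bmatrix} n-1 \\ k-1 \end{bmatrix}_q. \]
   Context: $q \geq 2$ is a prime power and $n,k,a$ are positive integers. The Gaussian binomial coefficient is $\begin{bmatrix} b \\ j \end{bmatrix}_q = \prod_{0 \leq i < j} \frac{q^{b-i}-1}{q^{j-i}-1}$. -}

module Defs where

open import Data.Nat as ℕ using (ℕ; zero; suc; _∸_; _^_)
open import Data.Nat.Primality using (Prime)
open import Data.Integer using (+_)
open import Data.Product using (Σ; _×_)
open import Relation.Binary.PropositionalEquality using (_≡_)
open import Data.Rational using (ℚ; _/_; _*_; 1ℚ)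

IsPrimePower : ℕ → Set
IsPrimePower q = Σ ℕ λ p → Σ ℕ λ e → Prime p × (1 ℕ.≤ e) × (q ≡ p ^ e)

-- the rational number m / d  (total: returns 0 if d = 0, which never
-- happens in our uses since q ≥ 2)
frac : ℕ → ℕ → ℚ
frac m zero    = + 0 / 1
frac m (suc d) = + m / suc d

⟦_⟧ : ℕ → ℚ
⟦ m ⟧ = + m / 1

prodℚ : ℕ → (ℕ → ℚ) → ℚ
prodℚ zero    f = 1ℚ
prodℚ (suc t) f = prodℚ t f * f t

gauss : ℕ → ℕ → ℕ → ℚ
gauss q b j = prodℚ j (λ i → frac (q ^ (b ∸ i) ∸ 1) (q ^ (j ∸ i) ∸ 1))

-- Write k = j + 1 and b = n − a − 1, so that n − 1 = a + b and k(k − 1) + (a − k)(k − 1) = aj.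
-- Each numerator factor of [a+b; j] satisfies q^{a+b−i} − 1 ≤ q^a q^{b−i}, hence
-- [a+b; j] ≤ q^{aj} [b; j] / ∏_{i<j} (1 − q^{−(b−i)}).  For q ≥ 2 an induction on j gives
-- ∏_{i<j} (1 − q^{−(b−i)}) ≥ 1 − q^{−(b−j)}, so (1 − q^{−(b−j)}) [a+b; j] ≤ q^{aj} [b; j],
-- which is the claim after dividing by q^{(a−k)(k−1)}.
module Submission where

module GaussNumerators where

  open import Data.Nat
  open import Data.Nat.Properties
  open import Algebra.Properties.CommutativeSemigroup *-commutativeSemigroup using (x∙yz≈y∙xz)
  open import Data.Nat.Tactic.RingSolver using (solve-∀; solve)
  open import Data.List.Base using (_∷_; [])
  open import Relation.Binary.PropositionalEquality

  prodℕ : ℕ → (ℕ → ℕ) → ℕ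
  prodℕ zero    f = 1
  prodℕ (suc t) f = prodℕ t f * f t

  prodℕ-mono-≤ : ∀ t {f g : ℕ → ℕ} → (∀ i → i < t → f i ≤ g i) → prodℕ t f ≤ prodℕ t g
  prodℕ-mono-≤ zero    f≤g = ≤-refl
  prodℕ-mono-≤ (suc t) f≤g = *-mono-≤ (prodℕ-mono-≤ t (λ i i<t → f≤g i (m<n⇒m<1+n i<t))) (f≤g t ≤-refl)

  prodℕ-positive : ∀ t {f : ℕ → ℕ} → (∀ i → i < t → 0 < f i) → 0 < prodℕ t f
  prodℕ-positive zero    pos = z<s
  prodℕ-positive (suc t) pos = *-mono-≤ (prodℕ-positive t (λ i i<t → pos i (m<n⇒m<1+n i<t))) (pos t ≤-refl)

  prodℕ-scale : ∀ t c (f : ℕ → ℕ) → prodℕ t (λ i → c * f i) ≡ c ^ t * prodℕ t f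
  prodℕ-scale zero    c f = refl
  prodℕ-scale (suc t) c f = begin
    prodℕ t (λ i → c * f i) * (c * f t)  ≡⟨ cong (_* (c * f t)) (prodℕ-scale t c f) ⟩
    c ^ t * prodℕ t f * (c * f t)        ≡⟨ shuffle (c ^ t) (prodℕ t f) c (f t) ⟩
    c * c ^ t * (prodℕ t f * f t)        ∎
    where
    open ≡-Reasoning
    shuffle : ∀ x p c y → x * p * (c * y) ≡ c * x * (p * y)
    shuffle = solve-∀

  powProd : ℕ → ℕ → ℕ → ℕ
  powProd q b j = prodℕ j (λ i → q ^ (b ∸ i))

  gaussNum : ℕ → ℕ → ℕ → ℕ
  gaussNum q b j = prodℕ j (λ i → q ^ (b ∸ i) ∸ 1)

  gaussFactor-positive : ∀ {q} → 2 ≤ q → ∀ {m i} → i < m → 0 < q ^ (m ∸ i) ∸ 1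
  gaussFactor-positive {q@(suc _)} 2≤q {m} {i} i<m = ∸-monoˡ-≤ 1 (begin
    2               ≤⟨ 2≤q ⟩
    q               ≡⟨ *-identityʳ q ⟨
    q ^ 1           ≤⟨ ^-monoʳ-≤ q (m<n⇒0<n∸m i<m) ⟩
    q ^ (m ∸ i)     ∎)
    where open ≤-Reasoning

  gaussNum-+-≤ : ∀ q a b j → j ≤ b → gaussNum q (a + b) j ≤ q ^ (a * j) * powProd q b j
  gaussNum-+-≤ q a b j j≤b = begin
    gaussNum q (a + b) j                      ≤⟨ prodℕ-mono-≤ j factor-≤ ⟩
    prodℕ j (λ i → q ^ a * q ^ (b ∸ i))       ≡⟨ prodℕ-scale j (q ^ a) (λ i → q ^ (b ∸ i)) ⟩
    (q ^ a) ^ j * powProd q b j               ≡⟨ cong (_* powProd q b j) (^-*-assoc q a j) ⟩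
    q ^ (a * j) * powProd q b j               ∎
    where
    open ≤-Reasoning
    factor-≤ : ∀ i → i < j → q ^ ((a + b) ∸ i) ∸ 1 ≤ q ^ a * q ^ (b ∸ i)
    factor-≤ i i<j = begin
      q ^ ((a + b) ∸ i) ∸ 1   ≤⟨ m∸n≤m _ 1 ⟩
      q ^ ((a + b) ∸ i)       ≡⟨ cong (q ^_) (+-∸-assoc a (<⇒≤ (<-≤-trans i<j j≤b))) ⟩
      q ^ (a + (b ∸ i))       ≡⟨ ^-distribˡ-+-* q a (b ∸ i) ⟩
      q ^ a * q ^ (b ∸ i)     ∎

  -- Equivalent to t (2s + 1) ≤ s², which holds because s ≥ 2t + 1.
  square-gap : ∀ q' t → let s = t + suc q' * suc t in t * suc s * suc s ≤ suc t * s * s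
  square-gap q' t = subst (t * suc s * suc s ≤_) (sym (expand q' t)) (m≤m+n _ _)
    where
    s : ℕ
    s = t + suc q' * suc t
    expand : ∀ q' t → let s = t + suc q' * suc t in
      suc t * s * s ≡ t * suc s * suc s + (suc t + q' * suc t + s * (q' * suc t))
    expand = solve-∀

  ratio-step : ∀ t s X Y → 0 < s → t * suc s * suc s ≤ suc t * s * s →
               s * X ≤ suc s * Y → t * (X * suc s) ≤ suc t * (Y * s)
  ratio-step t s X Y s>0 gap ih = *-cancelˡ-≤ s {{>-nonZero s>0}} (begin
    s * (t * (X * suc s))     ≡⟨ solve (t ∷ s ∷ X ∷ []) ⟩
    t * suc s * (s * X)       ≤⟨ *-monoʳ-≤ (t * suc s) ih ⟩
    t * suc s * (suc s * Y)   ≡⟨ solve (t ∷ s ∷ Y ∷ []) ⟩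
    t * suc s * suc s * Y     ≤⟨ *-monoˡ-≤ Y gap ⟩
    suc t * s * s * Y         ≡⟨ solve (t ∷ s ∷ Y ∷ []) ⟩
    s * (suc t * (Y * s))     ∎)
    where open ≤-Reasoning

  powProd-step : ∀ q' {T X Y} → 0 < T → let S = suc (suc q') * T in
    (S ∸ 1) * X ≤ S * Y → (T ∸ 1) * (X * S) ≤ T * (Y * (S ∸ 1))
  powProd-step q' {suc t} {X} {Y} _ =
    ratio-step t s X Y (<-≤-trans z<s (m≤n+m (suc q' * suc t) t)) (square-gap q' t)
    where
    s : ℕ
    s = t + suc q' * suc t

  suc[m∸1+n]≡m∸n : ∀ {m n} → n < m → suc (m ∸ suc n) ≡ m ∸ n
  suc[m∸1+n]≡m∸n {suc m} {zero}  _         = refl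
  suc[m∸1+n]≡m∸n {suc m} {suc n} (s<s n<m) = suc[m∸1+n]≡m∸n n<m

  -- ∏_{i<j} (1 − q^{-(b−i)}) ≥ 1 − q^{-(b−j)}, cleared of denominators.
  powProd-bound : ∀ {q} → 2 ≤ q → ∀ b j → j ≤ b →
    (q ^ (b ∸ j) ∸ 1) * powProd q b j ≤ q ^ (b ∸ j) * gaussNum q b j
  powProd-bound {q} _ b zero _ = *-monoˡ-≤ 1 (m∸n≤m (q ^ b) 1)
  powProd-bound {q@(suc (suc q'))} 2≤q@(s≤s (s≤s _)) b (suc j) j<b =
    subst (λ S → (T ∸ 1) * (X * S) ≤ T * (Y * (S ∸ 1))) (sym S≡q*T)
      (powProd-step q' (m^n>0 q (b ∸ suc j))
        (subst (λ S → (S ∸ 1) * X ≤ S * Y) S≡q*T (powProd-bound 2≤q b j (<⇒≤ j<b))))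
    where
    T X Y : ℕ
    T = q ^ (b ∸ suc j)
    X = powProd q b j
    Y = gaussNum q b j
    S≡q*T : q ^ (b ∸ j) ≡ q * T
    S≡q*T = cong (q ^_) (sym (suc[m∸1+n]≡m∸n j<b))

  gaussNum-+-bound : ∀ {q} → 2 ≤ q → ∀ a b j → j ≤ b →
    (q ^ (b ∸ j) ∸ 1) * gaussNum q (a + b) j ≤ q ^ (a * j) * (q ^ (b ∸ j) * gaussNum q b j)
  gaussNum-+-bound {q} 2≤q a b j j≤b = begin
    (S ∸ 1) * gaussNum q (a + b) j             ≤⟨ *-monoʳ-≤ (S ∸ 1) (gaussNum-+-≤ q a b j j≤b) ⟩
    (S ∸ 1) * (q ^ (a * j) * powProd q b j)   ≡⟨ x∙yz≈y∙xz (S ∸ 1) (q ^ (a * j)) (powProd q b j) ⟩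
    q ^ (a * j) * ((S ∸ 1) * powProd q b j)   ≤⟨ *-monoʳ-≤ (q ^ (a * j)) (powProd-bound 2≤q b j j≤b) ⟩
    q ^ (a * j) * (S * gaussNum q b j)        ∎
    where
    open ≤-Reasoning
    S : ℕ
    S = q ^ (b ∸ j)

  ^-split : ∀ q {a} j → suc j ≤ a → q ^ (a * j) ≡ q ^ (suc j * j) * q ^ ((a ∸ suc j) * j)
  ^-split q {a} j j<a = begin
    q ^ (a * j)                                 ≡⟨ cong (λ e → q ^ (e * j)) (m+[n∸m]≡n j<a) ⟨
    q ^ ((suc j + (a ∸ suc j)) * j)             ≡⟨ cong (q ^_) (*-distribʳ-+ j (suc j) (a ∸ suc j)) ⟩
    q ^ (suc j * j + (a ∸ suc j) * j)           ≡⟨ ^-distribˡ-+-* q (suc j * j) ((a ∸ suc j) * j) ⟩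
    q ^ (suc j * j) * q ^ ((a ∸ suc j) * j)     ∎
    where open ≡-Reasoning

  -- The theorem cross-multiplied; D will be the common denominator ∏_{i<j} (q^{j−i} − 1).
  gaussNum-cross-bound : ∀ {q} → 2 ≤ q → ∀ a b j D → suc j ≤ a → j ≤ b →
    let S = q ^ (b ∸ j); K = suc j * j; E = (a ∸ suc j) * j in
    1 * (S ∸ 1) * gaussNum q (a + b) j * (1 * D) ≤ q ^ K * gaussNum q b j * (q ^ E * S * D)
  gaussNum-cross-bound {q} 2≤q a b j D j<a j≤b = begin
    1 * (S ∸ 1) * gaussNum q (a + b) j * (1 * D)        ≡⟨ drop-ones (S ∸ 1) (gaussNum q (a + b) j) D ⟩
    (S ∸ 1) * gaussNum q (a + b) j * D                  ≤⟨ *-monoˡ-≤ D (gaussNum-+-bound 2≤q a b j j≤b) ⟩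
    q ^ (a * j) * (S * gaussNum q b j) * D              ≡⟨ cong (λ x → x * (S * gaussNum q b j) * D) (^-split q j j<a) ⟩
    q ^ K * q ^ E * (S * gaussNum q b j) * D            ≡⟨ regroup (q ^ K) (q ^ E) S (gaussNum q b j) D ⟩
    q ^ K * gaussNum q b j * (q ^ E * S * D)            ∎
    where
    open ≤-Reasoning
    S K E : ℕ
    S = q ^ (b ∸ j)
    K = suc j * j
    E = (a ∸ suc j) * j
    drop-ones : ∀ x y d → 1 * x * y * (1 * d) ≡ x * y * d
    drop-ones = solve-∀
    regroup : ∀ k e s y d → k * e * (s * y) * d ≡ k * y * (e * s * d)
    regroup = solve-∀

module Fractions where

  open import Defs
  open GaussNumerators using (prodℕ; prodℕ-positive; gaussNum; gaussFactor-positive)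
  open import Data.Nat as ℕ using (ℕ; zero; suc)
  open import Data.Nat.Properties using (+-identityʳ; m<n⇒m<1+n; ≤-refl)
  open import Data.Integer as ℤ using (+_)
  import Data.Integer.Properties as ℤ
  open import Data.Rational using (_*_; _-_; -_; _≤_; 1ℚ; toℚᵘ)
  open import Data.Rational.Properties
    using (toℚᵘ-injective; toℚᵘ-homo-*; toℚᵘ-homo-+; toℚᵘ-homo‿-; toℚᵘ-fromℚᵘ; toℚᵘ-cancel-≤)
  open import Data.Rational.Unnormalised as ℚᵘ using (_≃_; *≡*; *≤*)
  open import Data.Rational.Unnormalised.Properties as ℚᵘ using (module ≃-Reasoning)
  open import Relation.Binary.PropositionalEquality

  toℚᵘ-frac : ∀ m d → toℚᵘ (frac m (suc d)) ≃ + m ℚᵘ./ suc d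
  toℚᵘ-frac m d = toℚᵘ-fromℚᵘ (+ m ℚᵘ./ suc d)

  frac-* : ∀ a {b} c {d} → 0 ℕ.< b → 0 ℕ.< d → frac a b * frac c d ≡ frac (a ℕ.* c) (b ℕ.* d)
  frac-* a {suc b} c {suc d} _ _ = toℚᵘ-injective (begin
    toℚᵘ (frac a (suc b) * frac c (suc d))             ≈⟨ toℚᵘ-homo-* (frac a (suc b)) (frac c (suc d)) ⟩
    toℚᵘ (frac a (suc b)) ℚᵘ.* toℚᵘ (frac c (suc d))    ≈⟨ ℚᵘ.*-cong (toℚᵘ-frac a b) (toℚᵘ-frac c d) ⟩
    (+ a ℚᵘ./ suc b) ℚᵘ.* (+ c ℚᵘ./ suc d)              ≡⟨ cong (ℚᵘ._/ (suc b ℕ.* suc d)) (sym (ℤ.pos-* a c)) ⟩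
    + (a ℕ.* c) ℚᵘ./ (suc b ℕ.* suc d)                  ≈⟨ ℚᵘ.≃-sym (toℚᵘ-frac (a ℕ.* c) _) ⟩
    toℚᵘ (frac (a ℕ.* c) (suc b ℕ.* suc d))             ∎)
    where open ≃-Reasoning

  frac-≤ : ∀ a {b} c {d} → 0 ℕ.< b → 0 ℕ.< d → a ℕ.* d ℕ.≤ c ℕ.* b → frac a b ≤ frac c d
  frac-≤ a {suc b} c {suc d} _ _ ad≤cb = toℚᵘ-cancel-≤
    (ℚᵘ.≤-respˡ-≃ (ℚᵘ.≃-sym (toℚᵘ-frac a b)) (ℚᵘ.≤-respʳ-≃ (ℚᵘ.≃-sym (toℚᵘ-frac c d))
      (*≤* (subst₂ ℤ._≤_ (ℤ.pos-* a (suc d)) (ℤ.pos-* c (suc b)) (ℤ.+≤+ ad≤cb)))))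

  1-frac-1 : ∀ {S} → 0 ℕ.< S → 1ℚ - frac 1 S ≡ frac (S ℕ.∸ 1) S
  1-frac-1 {suc d} _ = toℚᵘ-injective (begin
    toℚᵘ (1ℚ - frac 1 (suc d))                      ≈⟨ toℚᵘ-homo-+ 1ℚ (- frac 1 (suc d)) ⟩
    toℚᵘ 1ℚ ℚᵘ.+ toℚᵘ (- frac 1 (suc d))            ≈⟨ ℚᵘ.+-congʳ (toℚᵘ 1ℚ) (toℚᵘ-homo‿- (frac 1 (suc d))) ⟩
    toℚᵘ 1ℚ ℚᵘ.- toℚᵘ (frac 1 (suc d))              ≈⟨ ℚᵘ.+-congʳ (toℚᵘ 1ℚ) (ℚᵘ.-‿cong (toℚᵘ-frac 1 d)) ⟩
    ℚᵘ.1ℚᵘ ℚᵘ.- (+ 1 ℚᵘ./ suc d)                    ≈⟨ *≡* (cong₂ ℤ._*_ (cong +_ (+-identityʳ d)) (cong (λ n → + suc n) (sym (+-identityʳ d)))) ⟩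
    + d ℚᵘ./ suc d                                   ≈⟨ ℚᵘ.≃-sym (toℚᵘ-frac d d) ⟩
    toℚᵘ (frac d (suc d))                            ∎)
    where open ≃-Reasoning

  prodℚ-frac : ∀ t (f g : ℕ → ℕ) → (∀ i → i ℕ.< t → 0 ℕ.< g i) →
               prodℚ t (λ i → frac (f i) (g i)) ≡ frac (prodℕ t f) (prodℕ t g)
  prodℚ-frac zero    f g g>0 = refl
  prodℚ-frac (suc t) f g g>0 = begin
    prodℚ t (λ i → frac (f i) (g i)) * frac (f t) (g t)  ≡⟨ cong (_* frac (f t) (g t)) (prodℚ-frac t f g g<t>0) ⟩
    frac (prodℕ t f) (prodℕ t g) * frac (f t) (g t)      ≡⟨ frac-* (prodℕ t f) (f t) (prodℕ-positive t g<t>0) (g>0 t ≤-refl) ⟩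
    frac (prodℕ t f ℕ.* f t) (prodℕ t g ℕ.* g t)         ∎
    where
    open ≡-Reasoning
    g<t>0 : ∀ i → i ℕ.< t → 0 ℕ.< g i
    g<t>0 i i<t = g>0 i (m<n⇒m<1+n i<t)

  gauss≡frac : ∀ {q} → 2 ℕ.≤ q → ∀ b j → gauss q b j ≡ frac (gaussNum q b j) (gaussNum q j j)
  gauss≡frac 2≤q b j = prodℚ-frac j _ _ (λ i i<j → gaussFactor-positive 2≤q i<j)

open import Defs
open GaussNumerators
open Fractions
open import Data.Nat using (ℕ; _∸_; _^_; _+_) renaming (_*_ to _*ℕ_; _≤_ to _≤ℕ_)
open import Data.Rational using (_*_; _-_; _≥_; 1ℚ)
open import Data.Nat.Base using (zero; suc; s≤s; z≤n; z<s; _<_; NonZero; NonTrivial; nonTrivial⇒n>1; nonTrivial⇒nonZero)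
open import Data.Nat.Properties
  using (m^n>0; m^n≢0; m≤m*n; *-mono-≤; ≤-refl; ≤-trans; ∸-monoˡ-≤; ∸-+-assoc; +-∸-assoc; m+[n∸m]≡n; m+n≤o⇒m≤o∸n; m+n≤o⇒n≤o)
open import Data.Nat.Primality using (prime⇒nonTrivial)
open import Data.Product using (_,_)
open import Data.Rational.Properties using (module ≤-Reasoning)
open import Relation.Binary.PropositionalEquality using (_≡_; refl; cong; cong₂; subst₂; module ≡-Reasoning)
open import Relation.Nullary using (contradiction)

gauss-tail-bound : ∀ q a b j → 2 ≤ℕ q → suc j ≤ℕ a → j ≤ℕ b →
  ⟦ q ^ (suc j *ℕ j) ⟧ * gauss q b j
    ≥ frac 1 (q ^ ((a ∸ suc j) *ℕ j)) * (1ℚ - frac 1 (q ^ (b ∸ j))) * gauss q (a + b) j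
gauss-tail-bound q@(suc (suc _)) a b j 2≤q@(s≤s (s≤s _)) j<a j≤b = begin
  frac 1 qᴱ * (1ℚ - frac 1 S) * gauss q (a + b) j
    ≡⟨ cong₂ (λ x y → frac 1 qᴱ * x * y) (1-frac-1 S>0) (gauss≡frac 2≤q (a + b) j) ⟩
  frac 1 qᴱ * frac (S ∸ 1) S * frac NA D
    ≡⟨ cong (_* frac NA D) (frac-* 1 (S ∸ 1) qᴱ>0 S>0) ⟩
  frac (1 *ℕ (S ∸ 1)) (qᴱ *ℕ S) * frac NA D
    ≡⟨ frac-* (1 *ℕ (S ∸ 1)) NA (*-mono-≤ qᴱ>0 S>0) D>0 ⟩
  frac (1 *ℕ (S ∸ 1) *ℕ NA) (qᴱ *ℕ S *ℕ D)
    ≤⟨ frac-≤ _ _ (*-mono-≤ (*-mono-≤ qᴱ>0 S>0) D>0) (*-mono-≤ (≤-refl {1}) D>0)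
         (gaussNum-cross-bound 2≤q a b j D j<a j≤b) ⟩
  frac (qᴷ *ℕ NB) (1 *ℕ D)
    ≡⟨ frac-* qᴷ NB z<s D>0 ⟨
  ⟦ qᴷ ⟧ * frac NB D
    ≡⟨ cong (⟦ qᴷ ⟧ *_) (gauss≡frac 2≤q b j) ⟨
  ⟦ qᴷ ⟧ * gauss q b j ∎
  where
  open ≤-Reasoning
  qᴷ qᴱ S NA NB D : ℕ
  qᴷ = q ^ (suc j *ℕ j)
  qᴱ = q ^ ((a ∸ suc j) *ℕ j)
  S = q ^ (b ∸ j)
  NA = gaussNum q (a + b) j
  NB = gaussNum q b j
  D = gaussNum q j j
  qᴱ>0 : 0 < qᴱ
  qᴱ>0 = m^n>0 q ((a ∸ suc j) *ℕ j)
  S>0 : 0 < S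
  S>0 = m^n>0 q (b ∸ j)
  D>0 : 0 < D
  D>0 = prodℕ-positive j (λ i i<j → gaussFactor-positive 2≤q i<j)

primePower⇒2≤ : ∀ {q} → IsPrimePower q → 2 ≤ℕ q
primePower⇒2≤ (p , suc e , p-prime , _ , refl) = ≤-trans (nonTrivial⇒n>1 p) (m≤m*n p (p ^ e))
  where
  instance
    p-nonTrivial : NonTrivial p
    p-nonTrivial = prime⇒nonTrivial p-prime
    p^e-nonZero : NonZero (p ^ e)
    p^e-nonZero = m^n≢0 p e {{nonTrivial⇒nonZero p}}

0<m≤o∸n⇒n+m≤o : ∀ {m} n {o} → 0 < m → m ≤ℕ o ∸ n → n + m ≤ℕ o
0<m≤o∸n⇒n+m≤o zero              0<m m≤o   = m≤o
0<m≤o∸n⇒n+m≤o (suc n) {zero}  0<m m≤0   = contradiction (≤-trans 0<m m≤0) λ ()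
0<m≤o∸n⇒n+m≤o (suc n) {suc o} 0<m m≤o∸n = s≤s (0<m≤o∸n⇒n+m≤o n 0<m m≤o∸n)

lemma3p3 : (q n k a : ℕ) → IsPrimePower q → 1 ≤ℕ n → 1 ≤ℕ k → 1 ≤ℕ a →
           k ≤ℕ a → a ≤ℕ n ∸ k →
           ⟦ q ^ (k *ℕ (k ∸ 1)) ⟧ * gauss q (n ∸ a ∸ 1) (k ∸ 1)
             ≥ frac 1 (q ^ ((a ∸ k) *ℕ (k ∸ 1)))
               * (1ℚ - frac 1 (q ^ (n ∸ a ∸ k)))
               * gauss q (n ∸ 1) (k ∸ 1)
lemma3p3 q n (suc j) a q-pp _ _ 0<a j<a a≤n∸k =
  subst₂ (λ c m → ⟦ q ^ (suc j *ℕ j) ⟧ * gauss q b j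
                    ≥ frac 1 (q ^ ((a ∸ suc j) *ℕ j)) * (1ℚ - frac 1 (q ^ c)) * gauss q m j)
    (∸-+-assoc (n ∸ a) 1 j) a+b≡n∸1
    (gauss-tail-bound q a b j (primePower⇒2≤ q-pp) j<a (∸-monoˡ-≤ 1 k≤n∸a))
  where
  b : ℕ
  b = n ∸ a ∸ 1
  k+a≤n : suc j + a ≤ℕ n
  k+a≤n = 0<m≤o∸n⇒n+m≤o (suc j) 0<a a≤n∸k
  k≤n∸a : suc j ≤ℕ n ∸ a
  k≤n∸a = m+n≤o⇒m≤o∸n (suc j) k+a≤n
  a+b≡n∸1 : a + b ≡ n ∸ 1
  a+b≡n∸1 = begin
    a + b               ≡⟨ +-∸-assoc a (≤-trans (s≤s z≤n) k≤n∸a) ⟨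
    a + (n ∸ a) ∸ 1     ≡⟨ cong (_∸ 1) (m+[n∸m]≡n (m+n≤o⇒n≤o (suc j) k+a≤n)) ⟩
    n ∸ 1               ∎
    where open ≡-Reasoning
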